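{- Let $F$ and $F'$ be neighboring runs of a string $T$ with the same period $p$ and equal Lyndon roots, where $F$ starts before $F'$. If $R$ is a layer of the pyramid $\mathbf{P}(F,F')$ and $U^2$ (an occurrence, i.e., a fragment of $T$) belongs to $\mathrm{frag\text{ - }squares}(R\cap(F\cup F'))$, then the first half of $U^2$ is contained in $F$ and the second half of $U^2$ is contained in $F'$.
   Context: Strings are 0-indexed; $T[i\,..\,j]$ is a fragment. A positive integer $q\le |S|$ is a period of $S$ if $S[i]=S[i+q]$ for all valid $i$; $\mathrm{per}(S)$ is the smallest period; $S$ is periodic if $\mathrm{per}(S)\le|S|/2$. A run of $T$ is a periodic fragment $T[a\,..\,b]$ with $q=\mathrm{per}(T[a\,..\,b])$ that cannot be extended: ($a=0$ or $T[a-1]\ne T[a-1+q]$) and ($b=|T|-1$ or $T[b+1]\ne T[b+1-q]$). The Lyndon root of a periodic string $S$ is the lexicographically smallest rotation of $S[0\,..\,\mathrm{per}(S))$. Fragments $T[a\,..\,b]$, $T[a'\,..\,b']$ are neighboring if $[a-1\,..\,b+1]\cap[a'\,..\,b']\ne\emptyset$; then $F\cup F'=T[\min(a,a')\,..\,\max(b,b')]$, $F\cap F'=T[\max(a,a')\,..\,\min(b,b')]$. A square $X^2=XX$ ($X$ non-empty) is generated by a periodic fragment $U$ if $X^2$ is a fragment contained in $U$ with $\mathrm{per}(X^2)=\mathrm{per}(U)$; $\mathrm{frag\text{ - }squares}(U)$ is the set of these. $\mathrm{subper}(U)=\min\{\mathrm{per}(X):X^2\in\mathrm{frag\text{ - }squares}(U)\}$;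 $U$ is subperiodic if $\mathrm{subper}(U)\le\mathrm{per}(U)/4$. The pyramid $\mathbf{P}(F,F')$ is the set of subperiodic runs $R$ of $T$ with $\mathrm{subper}(R)=p$ such that $R\cap(F\cup F')$ is periodic with period $\mathrm{per}(R)$; its elements are called layers. -}

module Defs where

open import Data.Nat using (ℕ; zero; suc; _+_; _*_; _∸_; _≤_; _<_; _⊔_; _⊓_)
open import Data.List using (List; []; _∷_; length; take; drop; _++_)
open import Data.Maybe using (Maybe; just; nothing)
open import Data.Product using (Σ; _×_; _,_)
open import Data.Sum using (_⊎_)
open import Relation.Binary.PropositionalEquality using (_≡_; _≢_)

-- Strings are lists over an alphabet A, 0-indexed.  T ! i = just T[i] for i < |T|.
_!_ : {A : Set} → List A → ℕ → Maybe A
[] ! _ = nothing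
(x ∷ xs) ! zero = just x
(x ∷ xs) ! suc i = xs ! i

-- A fragment T[a..b] (inclusive bounds) is represented by the pair of positions a, b.
Frag : {A : Set} → List A → ℕ → ℕ → Set
Frag T a b = (a ≤ b) × (b < length T)

len : ℕ → ℕ → ℕ
len a b = suc b ∸ a

IsPeriod : {A : Set} → List A → ℕ → ℕ → ℕ → Set
IsPeriod T a b q =
  (1 ≤ q) × (q ≤ len a b) × ((i : ℕ) → a ≤ i → i + q ≤ b → T ! i ≡ T ! (i + q))

Per : {A : Set} → List A → ℕ → ℕ → ℕ → Set
Per T a b q = IsPeriod T a b q × ((q' : ℕ) → IsPeriod T a b q' → q ≤ q')

PeriodicWithPer : {A : Set} → List A → ℕ → ℕ → ℕ → Set
PeriodicWithPer T a b q = Frag T a b × Per T a b q × (2 * q ≤ len a b)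

RunWithPer : {A : Set} → List A → ℕ → ℕ → ℕ → Set
RunWithPer T a b q =
  PeriodicWithPer T a b q
  × ((a ≡ 0) ⊎ Σ ℕ (λ a₀ → (a ≡ suc a₀) × (T ! a₀ ≢ T ! (a₀ + q))))
  × ((suc b ≡ length T) ⊎ (T ! suc b ≢ T ! (suc b ∸ q)))

IsRun : {A : Set} → List A → ℕ → ℕ → Set
IsRun T a b = Σ ℕ (λ q → RunWithPer T a b q)

slice : {A : Set} → List A → ℕ → ℕ → List A
slice T i n = take n (drop i T)

rot : {A : Set} → ℕ → List A → List A
rot k xs = drop k xs ++ take k xs

data LexLeq {A : Set} (_<_ : A → A → Set) : List A → List A → Set where
  nil  : {ys : List A} → LexLeq _<_ [] ys
  here : {x y : A} {xs ys : List A} → x < y → LexLeq _<_ (x ∷ xs) (y ∷ ys)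
  there : {x : A} {xs ys : List A} → LexLeq _<_ xs ys → LexLeq _<_ (x ∷ xs) (x ∷ ys)

LyndonRoot : {A : Set} → (A → A → Set) → List A → ℕ → ℕ → List A → Set
LyndonRoot _≺_ T a b L =
  Σ ℕ (λ q → PeriodicWithPer T a b q
    × Σ ℕ (λ k → (k < q) × (L ≡ rot k (slice T a q)))
    × ((k : ℕ) → k < q → LexLeq _≺_ L (rot k (slice T a q))))

-- Neighboring fragments: [a-1..b+1] ∩ [a'..b'] ≠ ∅
Neighboring : ℕ → ℕ → ℕ → ℕ → Set
Neighboring a b a' b' = Σ ℕ (λ i → (a ≤ suc i) × (i ≤ suc b) × (a' ≤ i) × (i ≤ b'))

-- The fragment T[s..s+2ℓ-1] is a square X² with X = T[s..s+ℓ-1] (ℓ ≥ 1).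
IsSquareAt : {A : Set} → List A → ℕ → ℕ → Set
IsSquareAt T s ℓ = (1 ≤ ℓ) × ((k : ℕ) → k < ℓ → T ! (s + k) ≡ T ! (s + ℓ + k))

InFragSquares : {A : Set} → List A → ℕ → ℕ → ℕ → ℕ → Set
InFragSquares T c d s ℓ =
  IsSquareAt T s ℓ × (c ≤ s) × (s + ℓ + ℓ ≤ suc d)
  × Σ ℕ (λ q → PeriodicWithPer T c d q × Per T s (s + ℓ + ℓ ∸ 1) q)

SubPer : {A : Set} → List A → ℕ → ℕ → ℕ → Set
SubPer T c d r =
  Σ ℕ (λ s → Σ ℕ (λ ℓ → InFragSquares T c d s ℓ × Per T s (s + ℓ ∸ 1) r))
  × ((s ℓ r' : ℕ) → InFragSquares T c d s ℓ → Per T s (s + ℓ ∸ 1) r' → r ≤ r')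

Subperiodic : {A : Set} → List A → ℕ → ℕ → Set
Subperiodic T c d =
  Σ ℕ (λ q → Σ ℕ (λ r → PeriodicWithPer T c d q × SubPer T c d r × (4 * r ≤ q)))

-- R = T[c..d] is a layer of P(F, F') with F = T[a..b], F' = T[a'..b'], p the
-- common period of F and F'.  R ∩ (F ∪ F') = T[max c (min a a') .. min d (max b b')].
InPyramid : {A : Set} → List A → (a b a' b' p c d : ℕ) → Set
InPyramid T a b a' b' p c d =
  IsRun T c d × Subperiodic T c d × SubPer T c d p
  × Σ ℕ (λ q → Per T c d q
      × PeriodicWithPer T (c ⊔ (a ⊓ a')) (d ⊓ (b ⊔ b')) q)

-- Since R is subperiodic with subper(R) = p, the square U² has minimal period
-- per(R ∩ (F ∪ F')) ≥ per(R) ≥ 4p; as ℓ is a period of U², ℓ ≥ 2p and U² is not p-periodic.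
-- Because U² has period ℓ, p-periodicity of one half transfers to the other, and a p-periodic
-- fragment overlapping a run of period p in at least p positions lies inside that run.  If the
-- first half stuck out of F, the second half would lie in F', both halves would be p-periodic,
-- and the first half would be forced into F after all or all of U² into F'.  Symmetrically, if
-- the second half started before F', the first half would lie in F and the second half would be
-- forced into F' or all of U² into F.
module Submission where

open import Defs
open import Data.Nat using (ℕ; suc; _+_; _*_; _∸_; _≤_; _<_; _⊔_; _⊓_; s≤s; s≤s⁻¹; _≤?_)
open import Data.Nat.Properties
open import Algebra.Properties.CommutativeSemigroup +-commutativeSemigroup
  using () renaming (xy∙z≈xz∙y to +-rightComm)
open import Data.List using (List; length)
open import Data.Product using (Σ; _×_; _,_; proj₁; proj₂)
open import Data.Sum using (inj₁; inj₂)
open import Data.Empty using (⊥)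
open import Relation.Nullary using (¬_; Dec; yes; no)
open import Relation.Binary.PropositionalEquality
open import Relation.Binary.Structures using (IsStrictTotalOrder)

-- q is a period of the half-open fragment T[x..y); unlike IsPeriod, q may exceed its length.
PeriodicOn : {A : Set} → List A → ℕ → ℕ → ℕ → Set
PeriodicOn T x y q = ∀ i → x ≤ i → i + q < y → T ! i ≡ T ! (i + q)

module _ {A : Set} (T : List A) where

  periodicOn-mono : ∀ {x y x' y' q} → x ≤ x' → y' ≤ y →
                    PeriodicOn T x y q → PeriodicOn T x' y' q
  periodicOn-mono x≤x' y'≤y per i x'≤i i+q<y' = per i (≤-trans x≤x' x'≤i) (<-≤-trans i+q<y' y'≤y)

  isPeriod⇒periodicOn : ∀ {x y q} → IsPeriod T x y q → PeriodicOn T x (suc y) q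
  isPeriod⇒periodicOn (_ , _ , per) i x≤i i+q<1+y = per i x≤i (s≤s⁻¹ i+q<1+y)

  module _ {x y ℓ : ℕ} (per-ℓ : PeriodicOn T x (y + ℓ) ℓ) where

    private
      shift : ∀ {i} → x ≤ i → i < y → T ! i ≡ T ! (i + ℓ)
      shift {i} x≤i i<y = per-ℓ i x≤i (+-monoˡ-< ℓ i<y)

      shifted-bound : ∀ i q → i + q < y → i + ℓ + q < y + ℓ
      shifted-bound i q i+q<y = subst (_< y + ℓ) (+-rightComm i q ℓ) (+-monoˡ-< ℓ i+q<y)

    periodicOn-shiftˡ : ∀ {q} → PeriodicOn T (x + ℓ) (y + ℓ) q → PeriodicOn T x y q
    periodicOn-shiftˡ {q} per i x≤i i+q<y = begin
      T ! i            ≡⟨ shift x≤i (≤-<-trans (m≤m+n i q) i+q<y) ⟩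
      T ! (i + ℓ)      ≡⟨ per (i + ℓ) (+-monoˡ-≤ ℓ x≤i) (shifted-bound i q i+q<y) ⟩
      T ! (i + ℓ + q)  ≡⟨ cong (T !_) (+-rightComm i ℓ q) ⟩
      T ! (i + q + ℓ)  ≡⟨ shift (≤-trans x≤i (m≤m+n i q)) i+q<y ⟨
      T ! (i + q)      ∎
      where open ≡-Reasoning

    periodicOn-shiftʳ : ∀ {q} → PeriodicOn T x y q → PeriodicOn T (x + ℓ) (y + ℓ) q
    periodicOn-shiftʳ {q} per j x+ℓ≤j j+q<y+ℓ
      with j ∸ ℓ | m∸n+n≡m (≤-trans (m≤n+m ℓ x) x+ℓ≤j)
    ... | i | refl = begin
      T ! (i + ℓ)      ≡⟨ shift x≤i (≤-<-trans (m≤m+n i q) i+q<y) ⟨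
      T ! i            ≡⟨ per i x≤i i+q<y ⟩
      T ! (i + q)      ≡⟨ shift (≤-trans x≤i (m≤m+n i q)) i+q<y ⟩
      T ! (i + q + ℓ)  ≡⟨ cong (T !_) (+-rightComm i q ℓ) ⟩
      T ! (i + ℓ + q)  ∎
      where
      open ≡-Reasoning
      x≤i : x ≤ i
      x≤i = +-cancelʳ-≤ ℓ x i x+ℓ≤j
      i+q<y : i + q < y
      i+q<y = +-cancelʳ-< ℓ (i + q) y (subst (_< y + ℓ) (+-rightComm i ℓ q) j+q<y+ℓ)

  square-periodicOn : ∀ {s ℓ} → IsSquareAt T s ℓ → PeriodicOn T s (s + ℓ + ℓ) ℓ
  square-periodicOn {s} {ℓ} (_ , halves) i s≤i i+ℓ<end with m≤n⇒∃[o]m+o≡n s≤i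
  ... | k , refl = trans (halves k k<ℓ) (cong (T !_) (+-rightComm s ℓ k))
    where
    k<ℓ : k < ℓ
    k<ℓ = +-cancelˡ-< s k ℓ (+-cancelʳ-< ℓ (s + k) (s + ℓ) i+ℓ<end)

  module _ {s ℓ : ℕ} (sq : IsSquareAt T s ℓ) where

    private
      1≤ℓ : 1 ≤ ℓ
      1≤ℓ = proj₁ sq

      -- Defs encodes U² by the inclusive end s + ℓ + ℓ ∸ 1.
      end+1 : suc (s + ℓ + ℓ ∸ 1) ≡ s + ℓ + ℓ
      end+1 = suc-∸1 (≤-trans 1≤ℓ (m≤n+m ℓ (s + ℓ)))
        where
        suc-∸1 : ∀ {n} → 1 ≤ n → suc (n ∸ 1) ≡ n
        suc-∸1 (s≤s _) = refl

      len≡ : len s (s + ℓ + ℓ ∸ 1) ≡ ℓ + ℓ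
      len≡ = begin
        suc (s + ℓ + ℓ ∸ 1) ∸ s  ≡⟨ cong (_∸ s) end+1 ⟩
        s + ℓ + ℓ ∸ s            ≡⟨ cong (_∸ s) (+-assoc s ℓ ℓ) ⟩
        s + (ℓ + ℓ) ∸ s          ≡⟨ m+n∸m≡n s (ℓ + ℓ) ⟩
        ℓ + ℓ                    ∎
        where open ≡-Reasoning

      square-isPeriod : ∀ q → 1 ≤ q → q ≤ ℓ + ℓ → PeriodicOn T s (s + ℓ + ℓ) q →
                        IsPeriod T s (s + ℓ + ℓ ∸ 1) q
      square-isPeriod q 1≤q q≤2ℓ per =
        1≤q , subst (q ≤_) (sym len≡) q≤2ℓ ,
        λ i s≤i i+q≤end → per i s≤i (subst (i + q <_) end+1 (s≤s i+q≤end))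

    square-per≤half : ∀ {Q} → Per T s (s + ℓ + ℓ ∸ 1) Q → Q ≤ ℓ
    square-per≤half (_ , minimal) = minimal ℓ (square-isPeriod ℓ 1≤ℓ (m≤m+n ℓ ℓ) (square-periodicOn sq))

    square-aperiodic-below-per : ∀ {Q q} → Per T s (s + ℓ + ℓ ∸ 1) Q →
                                 1 ≤ q → q < Q → ¬ PeriodicOn T s (s + ℓ + ℓ) q
    square-aperiodic-below-per {q = q} perU@(_ , minimal) 1≤q q<Q per =
      <⇒≱ q<Q (minimal q (square-isPeriod q 1≤q q≤2ℓ per))
      where
      q≤2ℓ : q ≤ ℓ + ℓ
      q≤2ℓ = ≤-trans (<⇒≤ q<Q) (≤-trans (square-per≤half perU) (m≤m+n ℓ ℓ))

  module _ {a b p : ℕ} (F : RunWithPer T a b p) where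

    run-periodicOn : PeriodicOn T a (suc b) p
    run-periodicOn = isPeriod⇒periodicOn (proj₁ (proj₁ (proj₂ (proj₁ F))))

    run-left-maximal : ∀ {x y} → PeriodicOn T x y p → x < a → a + p ≤ y → ⊥
    run-left-maximal {x} per x<a a+p≤y with proj₁ (proj₂ F)
    ... | inj₁ refl = n≮0 x<a
    ... | inj₂ (a₀ , refl , break) = break (per a₀ (s≤s⁻¹ x<a) a+p≤y)

    run-right-maximal : ∀ {x y} → PeriodicOn T x y p → y ≤ length T →
                        x + p ≤ suc b → suc b < y → ⊥
    run-right-maximal {x} {y} per y≤|T| x+p≤b+1 b+1<y with proj₂ (proj₂ F)
    ... | inj₁ b+1≡|T| = <-irrefl b+1≡|T| (<-≤-trans b+1<y y≤|T|)
    ... | inj₂ break = break (sym (subst (λ j → T ! e ≡ T ! j) e+p≡b+1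
                                   (per e (m+n≤o⇒m≤o∸n x x+p≤b+1) (subst (_< y) (sym e+p≡b+1) b+1<y))))
      where
      e : ℕ
      e = suc b ∸ p
      e+p≡b+1 : e + p ≡ suc b
      e+p≡b+1 = m∸n+n≡m (≤-trans (m≤n+m p x) x+p≤b+1)

  run-end-mono : ∀ {a b a' b' p} → RunWithPer T a b p → RunWithPer T a' b' p → a < a' → b ≤ b'
  run-end-mono {a} {b} {a'} {b'} {p} F F'@(((a'≤b' , _) , _ , 2p≤|F'|) , _) a<a' = ≮⇒≥ b'≮b
    where
    b'≮b : ¬ b' < b
    b'≮b b'<b = run-left-maximal F' (run-periodicOn F) a<a' (begin
      a' + p                ≤⟨ +-monoʳ-≤ a' (≤-trans (m≤m+n p (p + 0)) 2p≤|F'|) ⟩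
      a' + (suc b' ∸ a')    ≡⟨ m+[n∸m]≡n (≤-trans a'≤b' (n≤1+n b')) ⟩
      suc b'                ≤⟨ m≤n⇒m≤1+n b'<b ⟩
      suc b                 ∎)
      where open ≤-Reasoning

  module _ {a b a' b' p s ℓ : ℕ} (F : RunWithPer T a b p) (F' : RunWithPer T a' b' p)
           (a'≤b+1 : a' ≤ suc b) (a≤s : a ≤ s) (U²≤b'+1 : s + ℓ + ℓ ≤ suc b')
           (sq : IsSquareAt T s ℓ) (2p≤ℓ : p + p ≤ ℓ)
           (U²-aperiodic : ¬ PeriodicOn T s (s + ℓ + ℓ) p) where

    private
      U²≤|T| : s + ℓ + ℓ ≤ length T
      U²≤|T| = ≤-trans U²≤b'+1 (proj₂ (proj₁ (proj₁ F')))

      halves-periodicOn : PeriodicOn T s (s + ℓ + ℓ) ℓ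
      halves-periodicOn = square-periodicOn sq

    first-half-in-run : s + ℓ ≤ suc b
    first-half-in-run = ≮⇒≥ first-half-sticks-out
      where
      first-half-sticks-out : ¬ suc b < s + ℓ
      first-half-sticks-out b+1<s+ℓ = by-cases (a' ≤? s) (s + p ≤? suc b)
        where
        second-half : PeriodicOn T (s + ℓ) (s + ℓ + ℓ) p
        second-half = periodicOn-mono (≤-trans a'≤b+1 (<⇒≤ b+1<s+ℓ)) U²≤b'+1 (run-periodicOn F')

        first-half : PeriodicOn T s (s + ℓ) p
        first-half = periodicOn-shiftˡ halves-periodicOn second-half

        by-cases : Dec (a' ≤ s) → Dec (s + p ≤ suc b) → ⊥
        by-cases (yes a'≤s) _ = U²-aperiodic (periodicOn-mono a'≤s U²≤b'+1 (run-periodicOn F'))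
        by-cases (no a'≰s) (yes s+p≤b+1) =
          run-right-maximal F first-half (≤-trans (m≤m+n (s + ℓ) ℓ) U²≤|T|) s+p≤b+1 b+1<s+ℓ
        by-cases (no a'≰s) (no s+p≰b+1) = run-left-maximal F' first-half (≰⇒> a'≰s) (begin
          a' + p       ≤⟨ +-monoˡ-≤ p (<⇒≤ (≤-<-trans a'≤b+1 (≰⇒> s+p≰b+1))) ⟩
          s + p + p    ≡⟨ +-assoc s p p ⟩
          s + (p + p)  ≤⟨ +-monoʳ-≤ s 2p≤ℓ ⟩
          s + ℓ        ∎)
          where open ≤-Reasoning

    second-half-in-run : a' ≤ s + ℓ
    second-half-in-run = ≮⇒≥ second-half-starts-early
      where
      second-half-starts-early : ¬ s + ℓ < a'
      second-half-starts-early s+ℓ<a' = by-cases (s + ℓ + ℓ ≤? suc b) (a' + p ≤? s + ℓ + ℓ)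
        where
        first-half : PeriodicOn T s (s + ℓ) p
        first-half = periodicOn-mono a≤s (<⇒≤ (<-≤-trans s+ℓ<a' a'≤b+1)) (run-periodicOn F)

        second-half : PeriodicOn T (s + ℓ) (s + ℓ + ℓ) p
        second-half = periodicOn-shiftʳ halves-periodicOn first-half

        by-cases : Dec (s + ℓ + ℓ ≤ suc b) → Dec (a' + p ≤ s + ℓ + ℓ) → ⊥
        by-cases (yes U²≤b+1) _ = U²-aperiodic (periodicOn-mono a≤s U²≤b+1 (run-periodicOn F))
        by-cases (no U²≰b+1) (yes a'+p≤U²) = run-left-maximal F' second-half s+ℓ<a' a'+p≤U²
        by-cases (no U²≰b+1) (no a'+p≰U²) =
          run-right-maximal F second-half U²≤|T| (<⇒≤ (<-≤-trans s+ℓ+p<a' a'≤b+1)) (≰⇒> U²≰b+1)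
          where
          s+ℓ+p<a' : s + ℓ + p < a'
          s+ℓ+p<a' = +-cancelʳ-< p (s + ℓ + p) a' (begin-strict
            s + ℓ + p + p    ≡⟨ +-assoc (s + ℓ) p p ⟩
            s + ℓ + (p + p)  ≤⟨ +-monoʳ-≤ (s + ℓ) 2p≤ℓ ⟩
            s + ℓ + ℓ        <⟨ ≰⇒> a'+p≰U² ⟩
            a' + p           ∎)
            where open ≤-Reasoning

  layer-period-bound : ∀ {a b a' b' p c d Q} → InPyramid T a b a' b' p c d →
                       PeriodicWithPer T (c ⊔ (a ⊓ a')) (d ⊓ (b ⊔ b')) Q → 4 * p ≤ Q
  layer-period-bound {p = p} {Q = Q}
    (_ , (q₀ , r , (_ , per-R₀ , _) , ((s , ℓ , r-square , per-r) , _) , 4r≤q₀) ,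
     (_ , subper-minimal) , q , per-R , (_ , per-W , _)) (_ , per-W' , _) = begin
    4 * p  ≤⟨ *-monoʳ-≤ 4 (subper-minimal s ℓ r r-square per-r) ⟩
    4 * r  ≤⟨ 4r≤q₀ ⟩
    q₀     ≤⟨ proj₂ per-R₀ q (proj₁ per-R) ⟩
    q      ≤⟨ proj₂ per-W Q (proj₁ per-W') ⟩
    Q      ∎
    where open ≤-Reasoning

lemma13 : {A : Set} (_<ₐ_ : A → A → Set) → IsStrictTotalOrder _≡_ _<ₐ_ →
          (T : List A) (a b a' b' p : ℕ) →
          RunWithPer T a b p → RunWithPer T a' b' p →
          Σ (List A) (λ L → LyndonRoot _<ₐ_ T a b L × LyndonRoot _<ₐ_ T a' b' L) →
          Neighboring a b a' b' → a < a' →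
          (c d : ℕ) → InPyramid T a b a' b' p c d →
          (s ℓ : ℕ) → InFragSquares T (c ⊔ (a ⊓ a')) (d ⊓ (b ⊔ b')) s ℓ →
          (a ≤ s) × (s + ℓ ∸ 1 ≤ b) × (a' ≤ s + ℓ) × (s + ℓ + ℓ ∸ 1 ≤ b')
lemma13 _ _ T a b a' b' p F F' _ (i , _ , i≤b+1 , a'≤i , _) a<a' c d layer s ℓ
        (sq , W≤s , U²≤W , Q , per-W , per-U²) =
  a≤s , ∸-monoˡ-≤ 1 (first-half-in-run T F F' a'≤b+1 a≤s U²≤b'+1 sq 2p≤ℓ U²-aperiodic) ,
  second-half-in-run T F F' a'≤b+1 a≤s U²≤b'+1 sq 2p≤ℓ U²-aperiodic , ∸-monoˡ-≤ 1 U²≤b'+1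
  where
  a'≤b+1 : a' ≤ suc b
  a'≤b+1 = ≤-trans a'≤i i≤b+1

  a≤s : a ≤ s
  a≤s = ≤-trans (≤-trans (≤-reflexive (sym (m≤n⇒m⊓n≡m (<⇒≤ a<a')))) (m≤n⊔m c (a ⊓ a'))) W≤s

  U²≤b'+1 : s + ℓ + ℓ ≤ suc b'
  U²≤b'+1 = ≤-trans U²≤W (s≤s (≤-trans (m⊓n≤n d (b ⊔ b'))
                                       (≤-reflexive (m≤n⇒m⊔n≡n (run-end-mono T F F' a<a')))))

  1≤p : 1 ≤ p
  1≤p = proj₁ (proj₁ (proj₁ (proj₂ (proj₁ F))))

  2p≤Q : p + p ≤ Q
  2p≤Q = ≤-trans (+-monoʳ-≤ p (m≤m+n p (2 * p))) (layer-period-bound T {b = b} {b' = b'} layer per-W)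

  2p≤ℓ : p + p ≤ ℓ
  2p≤ℓ = ≤-trans 2p≤Q (square-per≤half T sq per-U²)

  U²-aperiodic : ¬ PeriodicOn T s (s + ℓ + ℓ) p
  U²-aperiodic = square-aperiodic-below-per T sq per-U² 1≤p (<-≤-trans (m<m+n p 1≤p) 2p≤Q)
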